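{- Let $p$ be a prime and $k$ a positive integer with base-$p$ representation $k=\sum_{i\ge 0} a_i p^i$ ($0\le a_i\le p-1$, all but finitely many zero). Then \[ S(pk,k)\equiv \prod_{i\ge 0}\binom{a_i+a_{i+1}}{a_i} \pmod p. \]
   Context: $S(n,k)$ is the Stirling number of the second kind (the number of partitions of an $n$-set into $k$ nonempty subsets). -}

module Defs where

open import Data.Nat using (ℕ; zero; suc; _+_; _*_)
open import Data.Nat.Combinatorics using (_C_)
open import Data.List using (List; []; _∷_)

S : ℕ → ℕ → ℕ
S zero    zero    = 1
S zero    (suc k) = 0
S (suc n) zero    = 0
S (suc n) (suc k) = suc k * S n (suc k) + S n k

fromDigits : ℕ → List ℕ → ℕ
fromDigits p []       = 0
fromDigits p (a ∷ as) = a + p * fromDigits p as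

-- ∏_{i} C(a_i + a_{i+1}, a_i), with a_i = 0 beyond the end of the list
digitProd : List ℕ → ℕ
digitProd []            = 1
digitProd (a ∷ [])      = (a + 0) C a
digitProd (a ∷ b ∷ as)  = ((a + b) C a) * digitProd (b ∷ as)

module Submission where

-- We compute in ℕ/p, the naturals with equality modulo p (a commutative
-- semiring, so the library's binomial theorem and finite sums apply).
--  1. Fermat's little theorem follows from (x + 1)^p ≡ x^p + 1.  Together with
--     the expansion x^n = Σ_{k ≤ x} S(n,k) · x(x-1)⋯(x-k+1) and cancellation of
--     k!, it makes each column k < p periodic: S(n + p - 1, k) ≡ S(n, k), n ≥ 1.
--  2. Column shift: S(n + p, k + p) ≡ S(n, k) + S(n + 1, k + p), by induction
--     on the recurrence; the base column uses periodicity of column p - 1.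
--  3. Hence W K s = S(K + s(p - 1), K) obeys Pascal's rule in (K/p, s), giving
--     S(pK, K) ≡ C(K + q, q) for K = qp + r, r < p (the case r = 0 also needs
--     C((t+1)p + t, t+1) ≡ 0).
--  4. Lucas' theorem C(np + a, mp + b) ≡ C(a, b) C(n, m), proved from the
--     analogous shift rule for binomials, turns C(K + q, q) into
--     C(a + b, a) · S(pM, M) for K = Mp + a, M = M′p + b; induction on the
--     digit list gives the theorem.


open import Defs
open import Algebra.Bundles using (CommutativeSemiring)
open import Algebra.Definitions using (Congruent₂)
open import Algebra.Structures using (IsCommutativeMonoid)
open import Algebra.Structures.Biased using (isCommutativeSemiringˡ)
open import Data.Empty using (⊥-elim)
open import Data.Fin using (toℕ; fromℕ; inject₁)
open import Data.Fin.Properties using (toℕ<n; toℕ-inject₁; toℕ-fromℕ)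
open import Data.List using (List; []; _∷_)
open import Data.List.Relation.Unary.All using (All; []; _∷_)
open import Data.Nat
  using (ℕ; zero; suc; _+_; _*_; _∸_; _^_; _%_; _/_; _!; _≤_; _<_; z≤n; s≤s; NonZero; pred)
open import Data.Nat.Combinatorics
  using (_C_; nCn≡1; nCk≡nC[n∸k]; nCk+nC[k+1]≡[n+1]C[k+1]; k>n⇒nCk≡0; nCk≡n!/k![n-k]!; k![n∸k]!∣n!)
open import Data.Nat.Combinatorics.Base using (_P′_)
open import Data.Nat.Combinatorics.Specification using (nP′n≡n!)
open import Data.Nat.DivMod
  using (%-distribˡ-+; %-distribˡ-*; [m+kn]%n≡m%n; [m+n]%n≡m%n; m*n%n≡0; m≡m%n+[m/n]*n; m%n<n; m/n*n≡m)
open import Data.Nat.Divisibility using (_∣_; divides; n∣m⇒m%n≡0; ∣⇒≤; m∣m*n; ∣m⇒∣m*n)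
open import Data.Nat.Induction using (<-rec)
open import Data.Nat.Primality using (Prime; euclidsLemma; prime⇒nonZero; ¬prime[0]; ¬prime[1])
import Data.Nat.Properties as ℕ
open import Data.Nat.Tactic.RingSolver using (solve-∀)
open import Data.Product using (Σ; _×_; _,_)
open import Data.Sum using (inj₁; inj₂)
open import Level using (0ℓ)
open import Relation.Nullary using (¬_)
import Relation.Binary.PropositionalEquality as ≡
open ≡ using (_≡_; cong; cong₂)

module IndexedSums {c ℓ} (R : CommutativeSemiring c ℓ) where

  open CommutativeSemiring R using (Carrier; _≈_; 0#; setoid; semiring; trans)
    renaming (_+_ to _⊕_; _*_ to _⊗_)
  open import Algebra.Properties.Semiring.Sum semiring
    using (sum; sum-cong-≋; sum-cong-≗; sum-init-last; sum-replicate-zero; *-distribˡ-sum; ∑-distrib-+)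
  open import Relation.Binary.Reasoning.Setoid setoid

  Σ< : ℕ → (ℕ → Carrier) → Carrier
  Σ< n f = sum {n} (λ i → f (toℕ i))

  Σ<-cong : ∀ n {f g} → (∀ k → k < n → f k ≈ g k) → Σ< n f ≈ Σ< n g
  Σ<-cong n f≈g = sum-cong-≋ (λ i → f≈g (toℕ i) (toℕ<n i))

  Σ<-cong-≡ : ∀ n {f g} → (∀ k → f k ≡ g k) → Σ< n f ≡ Σ< n g
  Σ<-cong-≡ n f≗g = sum-cong-≗ {n} (λ i → f≗g (toℕ i))

  Σ<-distrib-+ : ∀ n f g → Σ< n (λ k → f k ⊕ g k) ≈ Σ< n f ⊕ Σ< n g
  Σ<-distrib-+ n f g = ∑-distrib-+ {n} (λ i → f (toℕ i)) (λ i → g (toℕ i))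

  Σ<-distribˡ : ∀ n x f → x ⊗ Σ< n f ≈ Σ< n (λ k → x ⊗ f k)
  Σ<-distribˡ n x f = *-distribˡ-sum {n} x (λ i → f (toℕ i))

  Σ<-zero : ∀ n {f} → (∀ k → k < n → f k ≈ 0#) → Σ< n f ≈ 0#
  Σ<-zero n f≈0 = trans (Σ<-cong n f≈0) (sum-replicate-zero n)

  Σ<-last : ∀ n f → Σ< (suc n) f ≈ Σ< n f ⊕ f n
  Σ<-last n f = begin
    Σ< (suc n) f
      ≈⟨ sum-init-last (λ i → f (toℕ i)) ⟩
    sum {n} (λ i → f (toℕ (inject₁ i))) ⊕ f (toℕ (fromℕ n))
      ≡⟨ cong₂ _⊕_ (sum-cong-≗ {n} (λ i → cong f (toℕ-inject₁ i))) (cong f (toℕ-fromℕ n)) ⟩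
    Σ< n f ⊕ f n
      ∎

module Congruence (m : ℕ) .{{_ : NonZero m}} where

  infix 4 _≈_
  record _≈_ (x y : ℕ) : Set where
    constructor mod-eq
    field residues : x % m ≡ y % m
  open _≈_ public

  ≡⇒≈ : ∀ {x y} → x ≡ y → x ≈ y
  ≡⇒≈ x≡y = mod-eq (cong (_% m) x≡y)

  ≈-refl : ∀ {x} → x ≈ x
  ≈-refl = mod-eq ≡.refl

  ≈-sym : ∀ {x y} → x ≈ y → y ≈ x
  ≈-sym (mod-eq e) = mod-eq (≡.sym e)

  ≈-trans : ∀ {x y z} → x ≈ y → y ≈ z → x ≈ z
  ≈-trans (mod-eq e) (mod-eq f) = mod-eq (≡.trans e f)

  +-cong : Congruent₂ _≈_ _+_
  +-cong {x} {y} {u} {v} (mod-eq x≈y) (mod-eq u≈v) = mod-eq (begin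
    (x + u) % m          ≡⟨ %-distribˡ-+ x u m ⟩
    (x % m + u % m) % m  ≡⟨ cong₂ (λ a b → (a + b) % m) x≈y u≈v ⟩
    (y % m + v % m) % m  ≡⟨ %-distribˡ-+ y v m ⟨
    (y + v) % m          ∎)
    where open ≡.≡-Reasoning

  *-cong : Congruent₂ _≈_ _*_
  *-cong {x} {y} {u} {v} (mod-eq x≈y) (mod-eq u≈v) = mod-eq (begin
    (x * u) % m            ≡⟨ %-distribˡ-* x u m ⟩
    (x % m * (u % m)) % m  ≡⟨ cong₂ (λ a b → (a * b) % m) x≈y u≈v ⟩
    (y % m * (v % m)) % m  ≡⟨ %-distribˡ-* y v m ⟨
    (y * v) % m            ∎)
    where open ≡.≡-Reasoning

  +-congˡ : ∀ a {x y} → x ≈ y → a + x ≈ a + y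
  +-congˡ a = +-cong (≈-refl {a})

  +-congʳ : ∀ b {x y} → x ≈ y → x + b ≈ y + b
  +-congʳ b x≈y = +-cong x≈y (≈-refl {b})

  *-congˡ : ∀ a {x y} → x ≈ y → a * x ≈ a * y
  *-congˡ a = *-cong (≈-refl {a})

  *-congʳ : ∀ b {x y} → x ≈ y → x * b ≈ y * b
  *-congʳ b x≈y = *-cong x≈y (≈-refl {b})

  descend : ∀ {_∙_ ε} → IsCommutativeMonoid _≡_ _∙_ ε → Congruent₂ _≈_ _∙_ →
            IsCommutativeMonoid _≈_ _∙_ ε
  descend M ∙-cong = record
    { isMonoid = record
      { isSemigroup = record
        { isMagma = record
          { isEquivalence = record { refl = ≈-refl ; sym = ≈-sym ; trans = ≈-trans }
          ; ∙-cong = ∙-cong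
          }
        ; assoc = λ x y z → ≡⇒≈ (assoc x y z)
        }
      ; identity = (λ x → ≡⇒≈ (identityˡ x)) , (λ x → ≡⇒≈ (identityʳ x))
      }
    ; comm = λ x y → ≡⇒≈ (comm x y)
    }
    where open IsCommutativeMonoid M using (assoc; identityˡ; identityʳ; comm)

  ℕ/m : CommutativeSemiring 0ℓ 0ℓ
  ℕ/m = record
    { isCommutativeSemiring = isCommutativeSemiringˡ record
      { +-isCommutativeMonoid = descend ℕ.+-0-isCommutativeMonoid +-cong
      ; *-isCommutativeMonoid = descend ℕ.*-1-isCommutativeMonoid *-cong
      ; distribʳ              = λ x y z → ≡⇒≈ (ℕ.*-distribʳ-+ x y z)
      ; zeroˡ                 = λ x → ≈-refl
      }
    }

  open IndexedSums ℕ/m public using (Σ<; Σ<-cong; Σ<-zero; Σ<-last)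
  open import Algebra.Definitions.RawSemiring (CommutativeSemiring.rawSemiring ℕ/m) public
    using () renaming (_^_ to _^ₘ_; _×_ to _×ₘ_)

  ×ₘ-ℕ : ∀ n x → n ×ₘ x ≡ n * x
  ×ₘ-ℕ zero    x = ≡.refl
  ×ₘ-ℕ (suc n) x = cong (x +_) (×ₘ-ℕ n x)

  ^ₘ-ℕ : ∀ x n → x ^ₘ n ≡ x ^ n
  ^ₘ-ℕ x zero    = ≡.refl
  ^ₘ-ℕ x (suc n) = cong (x *_) (^ₘ-ℕ x n)

  binomialTerm-ℕ : ∀ n k x → (n C k) ×ₘ (x ^ₘ k * 1 ^ₘ (n ∸ k)) ≡ (n C k) * x ^ k
  binomialTerm-ℕ n k x = begin
    (n C k) ×ₘ (x ^ₘ k * 1 ^ₘ (n ∸ k))  ≡⟨ ×ₘ-ℕ (n C k) _ ⟩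
    (n C k) * (x ^ₘ k * 1 ^ₘ (n ∸ k))  ≡⟨ cong₂ (λ a b → (n C k) * (a * b)) (^ₘ-ℕ x k) (^ₘ-ℕ 1 (n ∸ k)) ⟩
    (n C k) * (x ^ k * 1 ^ (n ∸ k))    ≡⟨ cong (λ a → (n C k) * (x ^ k * a)) (ℕ.^-zeroˡ (n ∸ k)) ⟩
    (n C k) * (x ^ k * 1)              ≡⟨ cong ((n C k) *_) (ℕ.*-identityʳ (x ^ k)) ⟩
    (n C k) * x ^ k                    ∎
    where open ≡.≡-Reasoning

  multiple≈0 : ∀ {x} → m ∣ x → x ≈ 0
  multiple≈0 {x} m∣x = mod-eq (≡.trans (n∣m⇒m%n≡0 x m m∣x) (≡.sym (m*n%n≡0 0 m)))

  +-multiple : ∀ x c → x + c * m ≈ x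
  +-multiple x c = mod-eq ([m+kn]%n≡m%n x c m)

  +-modulus : ∀ x → x + m ≈ x
  +-modulus x = mod-eq ([m+n]%n≡m%n x m)

  -- Additive cancellation: x ≈ x + a·m = (a + x) + a·(m - 1), likewise for y.
  +-cancelˡ : ∀ {a b x y} → a ≈ b → a + x ≈ b + y → x ≈ y
  +-cancelˡ {a} {b} {x} {y} a≈b eq =
    ≈-trans (≈-sym (+-multiple x a)) (≈-trans (≡⇒≈ (regroup x a))
      (≈-trans (+-cong eq (*-cong a≈b (≈-refl {pred m})))
        (≈-trans (≡⇒≈ (≡.sym (regroup y b))) (+-multiple y b))))
    where
    regroup : ∀ z c → z + c * m ≡ c + z + c * pred m
    regroup z c = ≡.trans (cong (λ n → z + c * n) (≡.sym (ℕ.suc-pred m))) (ring z c (pred m))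
      where
      ring : ∀ z c n → z + c * suc n ≡ c + z + c * n
      ring = solve-∀

  Σ<-top : ∀ k {f g} → (∀ j → j < k → f j ≈ g j) → Σ< (suc k) f ≈ Σ< (suc k) g → f k ≈ g k
  Σ<-top k {f} {g} f≈g total = +-cancelˡ (Σ<-cong k f≈g)
    (≈-trans (≈-sym (Σ<-last k f)) (≈-trans total (Σ<-last k g)))

  ≈⇒∣∸ : ∀ {x y} → x ≈ y → m ∣ x ∸ y
  ≈⇒∣∸ {x} {y} (mod-eq eq) = divides (x / m ∸ y / m) (begin
    x ∸ y                                      ≡⟨ cong₂ _∸_ (m≡m%n+[m/n]*n x m) (m≡m%n+[m/n]*n y m) ⟩
    (x % m + x / m * m) ∸ (y % m + y / m * m)  ≡⟨ cong (λ r → (r + x / m * m) ∸ (y % m + y / m * m)) eq ⟩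
    (y % m + x / m * m) ∸ (y % m + y / m * m)  ≡⟨ ℕ.[m+n]∸[m+o]≡n∸o (y % m) _ _ ⟩
    x / m * m ∸ y / m * m                      ≡⟨ ℕ.*-distribʳ-∸ m (x / m) (y / m) ⟨
    (x / m ∸ y / m) * m                        ∎)
    where open ≡.≡-Reasoning

  ∣∸⇒≈ : ∀ {x y} → y ≤ x → m ∣ x ∸ y → x ≈ y
  ∣∸⇒≈ {x} {y} y≤x (divides k eq) = mod-eq (begin
    x % m              ≡⟨ cong (_% m) (ℕ.m+[n∸m]≡n y≤x) ⟨
    (y + (x ∸ y)) % m  ≡⟨ cong (λ d → (y + d) % m) eq ⟩
    (y + k * m) % m    ≡⟨ [m+kn]%n≡m%n y k m ⟩
    y % m              ∎)
    where open ≡.≡-Reasoning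

  *-cancelʳ-≤ : Prime m → ∀ {f x y} → ¬ m ∣ f → y ≤ x → x * f ≈ y * f → x ≈ y
  *-cancelʳ-≤ pr {f} {x} {y} m∤f y≤x eq
    with euclidsLemma (x ∸ y) f pr (≡.subst (m ∣_) (≡.sym (ℕ.*-distribʳ-∸ f x y)) (≈⇒∣∸ eq))
  ... | inj₁ m∣x∸y = ∣∸⇒≈ y≤x m∣x∸y
  ... | inj₂ m∣f   = ⊥-elim (m∤f m∣f)

  *-cancelʳ : Prime m → ∀ {f x y} → ¬ m ∣ f → x * f ≈ y * f → x ≈ y
  *-cancelʳ pr {f} {x} {y} m∤f eq with ℕ.≤-total y x
  ... | inj₁ y≤x = *-cancelʳ-≤ pr m∤f y≤x eq
  ... | inj₂ x≤y = ≈-sym (*-cancelʳ-≤ pr m∤f x≤y (≈-sym eq))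

S-vanish : ∀ {n k} → n < k → S n k ≡ 0
S-vanish {zero}  {suc k} _ = ≡.refl
S-vanish {suc n} {suc k} (s≤s n<k)
  rewrite S-vanish (ℕ.m<n⇒m<1+n n<k) | S-vanish n<k = ≡.trans (ℕ.+-identityʳ _) (ℕ.*-zeroʳ (suc k))

S-diag : ∀ n → S n n ≡ 1
S-diag zero = ≡.refl
S-diag (suc n) rewrite S-vanish (ℕ.n<1+n n) | S-diag n = cong (_+ 1) (ℕ.*-zeroʳ (suc n))

P′-vanish : ∀ {x k} → x < k → x P′ k ≡ 0
P′-vanish {x} {suc k} (s≤s x≤k) = cong (_* (x P′ k)) (ℕ.m≤n⇒m∸n≡0 x≤k)

P′-step : ∀ x k → x * (x P′ k) ≡ x P′ suc k + k * (x P′ k)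
P′-step x k with ℕ.≤-<-connex k x
... | inj₁ k≤x = ≡.trans (cong (_* (x P′ k)) (≡.sym (ℕ.m∸n+n≡m k≤x))) (ℕ.*-distribʳ-+ (x P′ k) (x ∸ k) k)
... | inj₂ x<k rewrite P′-vanish x<k =
  ≡.trans (ℕ.*-zeroʳ x) (≡.sym (cong₂ _+_ (ℕ.*-zeroʳ (x ∸ k)) (ℕ.*-zeroʳ k)))

module PowerExpansion where

  open IndexedSums ℕ.+-*-commutativeSemiring
  open ≡.≡-Reasoning

  power-expansion : ∀ m x → x ^ m ≡ Σ< (suc x) (λ k → S m k * (x P′ k))
  power-expansion zero x = cong (1 +_) (≡.sym (Σ<-zero x {λ _ → 0} (λ _ _ → ≡.refl)))
  power-expansion (suc m) x = begin
    x * x ^ m                                         ≡⟨ cong (x *_) (power-expansion m x) ⟩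
    x * Σ< (suc x) (λ k → s k * F k)                  ≡⟨ Σ<-distribˡ (suc x) x (λ k → s k * F k) ⟩
    Σ< (suc x) (λ k → x * (s k * F k))                ≡⟨ Σ<-cong-≡ (suc x) multiply ⟩
    Σ< (suc x) (λ k → G k + k * (s k * F k))          ≡⟨ Σ<-distrib-+ (suc x) G (λ k → k * (s k * F k)) ⟩
    Σ< (suc x) G + Σ< x H                             ≡⟨ cong (_+ Σ< x H) drop-last ⟩
    Σ< x G + Σ< x H                                   ≡⟨ Σ<-distrib-+ x G H ⟨
    Σ< x (λ k → G k + H k)                            ≡⟨ Σ<-cong-≡ x recurrence ⟩
    Σ< (suc x) (λ k → S (suc m) k * F k)              ∎
    where
    s F G H : ℕ → ℕ
    s k = S m k
    F k = x P′ k
    G k = s k * F (suc k)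
    H k = suc k * (s (suc k) * F (suc k))

    multiply : ∀ k → x * (s k * F k) ≡ G k + k * (s k * F k)
    multiply k = ≡.trans (ring₁ x (s k) (F k)) (≡.trans (cong (s k *_) (P′-step x k)) (ring₂ (s k) (F (suc k)) k (F k)))
      where
      ring₁ : ∀ x s F → x * (s * F) ≡ s * (x * F)
      ring₁ = solve-∀
      ring₂ : ∀ s F′ k F → s * (F′ + k * F) ≡ s * F′ + k * (s * F)
      ring₂ = solve-∀

    -- the term k = x drops out since x P′ (x+1) = 0
    drop-last : Σ< (suc x) G ≡ Σ< x G
    drop-last = begin
      Σ< (suc x) G               ≡⟨ Σ<-last x G ⟩
      Σ< x G + s x * F (suc x)   ≡⟨ cong (λ t → Σ< x G + s x * t) (P′-vanish (ℕ.n<1+n x)) ⟩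
      Σ< x G + s x * 0           ≡⟨ cong (Σ< x G +_) (ℕ.*-zeroʳ (s x)) ⟩
      Σ< x G + 0                 ≡⟨ ℕ.+-identityʳ _ ⟩
      Σ< x G                     ∎

    recurrence : ∀ k → G k + H k ≡ S (suc m) (suc k) * F (suc k)
    recurrence k = ring (s k) (F (suc k)) k (s (suc k))
      where
      ring : ∀ a F k b → a * F + suc k * (b * F) ≡ (suc k * b + a) * F
      ring = solve-∀

C-times-factorials : ∀ {n k} → k ≤ n → (n C k) * (k ! * (n ∸ k) !) ≡ n !
C-times-factorials {n} {k} k≤n =
  ≡.trans (cong (_* (k ! * (n ∸ k) !)) (nCk≡n!/k![n-k]! k≤n))
          (m/n*n≡m {{ℕ._!*_!≢0 k (n ∸ k)}} (k![n∸k]!∣n! k≤n))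

C-symmetric : ∀ a b → (a + b) C b ≡ (a + b) C a
C-symmetric a b = ≡.trans (nCk≡nC[n∸k] (ℕ.m≤n+m b a)) (cong ((a + b) C_) (ℕ.m+n∸n≡m a b))

carry< : ∀ {m a b c} → a < m → a + b ≡ c + m → c < b
carry< {m} {a} {b} {c} a<m a+b≡c+m = ℕ.+-cancelʳ-< m c b (begin-strict
  c + m  ≡⟨ a+b≡c+m ⟨
  a + b  <⟨ ℕ.+-monoˡ-< b a<m ⟩
  m + b  ≡⟨ ℕ.+-comm m b ⟩
  b + m  ∎)
  where open ℕ.≤-Reasoning

pascal : ∀ n k → suc n C suc k ≡ (n C k) + (n C suc k)
pascal n k = ≡.sym (nCk+nC[k+1]≡[n+1]C[k+1] n k)

module ModP (p₂ : ℕ) (prime : Prime (suc (suc p₂))) where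

  p₁ p : ℕ
  p₁ = suc p₂
  p  = suc p₁

  open Congruence p
  open PowerExpansion using (power-expansion)
  open import Relation.Binary.Reasoning.Setoid (CommutativeSemiring.setoid ℕ/m)
  import Algebra.Properties.CommutativeSemiring.Binomial ℕ/m as Binomial

  p∤n! : ∀ {n} → n < p → ¬ p ∣ n !
  p∤n! {zero}  _   p∣1 with ∣⇒≤ p∣1
  ... | s≤s ()
  p∤n! {suc n} n<p p∣n! with euclidsLemma (suc n) (n !) prime p∣n!
  ... | inj₁ p∣1+n = ℕ.<⇒≱ n<p (∣⇒≤ p∣1+n)
  ... | inj₂ p∣n!  = p∤n! (ℕ.<-trans (ℕ.n<1+n n) n<p) p∣n!

  p∣pCk : ∀ {k} → 0 < k → k < p → p ∣ p C k
  p∣pCk {k} 0<k k<p with euclidsLemma (p C k) (k ! * (p ∸ k) !) prime p∣p!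
    where
    p∣p! : p ∣ (p C k) * (k ! * (p ∸ k) !)
    p∣p! = ≡.subst (p ∣_) (≡.sym (C-times-factorials (ℕ.<⇒≤ k<p))) (m∣m*n (p₁ !))
  ... | inj₁ p∣pCk = p∣pCk
  ... | inj₂ p∣k![p-k]! with euclidsLemma (k !) ((p ∸ k) !) prime p∣k![p-k]!
  ...   | inj₁ p∣k!     = ⊥-elim (p∤n! k<p p∣k!)
  ...   | inj₂ p∣[p-k]! = ⊥-elim (p∤n! (ℕ.∸-monoʳ-< 0<k (ℕ.<⇒≤ k<p)) p∣[p-k]!)

  -- Freshman's dream: (x + 1)^p ≡ x^p + 1, as the inner binomial coefficients vanish.
  freshman : ∀ x → (x + 1) ^ p ≈ x ^ p + 1
  freshman x = begin
    (x + 1) ^ p                              ≡⟨ ^ₘ-ℕ (x + 1) p ⟨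
    (x + 1) ^ₘ p                             ≈⟨ Binomial.theorem p x 1 ⟩
    t 0 + Σ< p (λ k → t (suc k))             ≈⟨ +-congˡ (t 0) (Σ<-last p₁ (λ k → t (suc k))) ⟩
    t 0 + (Σ< p₁ (λ k → t (suc k)) + t p)    ≈⟨ +-congˡ (t 0) (+-congʳ (t p) (Σ<-zero p₁ inner)) ⟩
    t 0 + (0 + t p)                          ≡⟨ cong₂ _+_ (term 0) (≡.trans (term p) (cong (_* x ^ p) (nCn≡1 p))) ⟩
    1 + 1 * x ^ p                            ≡⟨ ℕ.+-comm 1 (1 * x ^ p) ⟩
    1 * x ^ p + 1                            ≡⟨ cong (_+ 1) (ℕ.*-identityˡ (x ^ p)) ⟩
    x ^ p + 1                                ∎
    where
    t : ℕ → ℕ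
    t k = (p C k) ×ₘ (x ^ₘ k * 1 ^ₘ (p ∸ k))

    term : ∀ k → t k ≡ (p C k) * x ^ k
    term k = binomialTerm-ℕ p k x

    inner : ∀ k → k < p₁ → t (suc k) ≈ 0
    inner k k<p₁ = ≈-trans (≡⇒≈ (term (suc k))) (multiple≈0 (∣m⇒∣m*n (x ^ suc k) (p∣pCk (s≤s z≤n) (s≤s k<p₁))))

  fermat : ∀ x → x ^ p ≈ x
  fermat zero    = ≈-refl
  fermat (suc x) = begin
    suc x ^ p      ≡⟨ cong (_^ p) (ℕ.+-comm 1 x) ⟩
    (x + 1) ^ p    ≈⟨ freshman x ⟩
    x ^ p + 1      ≈⟨ +-congʳ 1 (fermat x) ⟩
    x + 1          ≡⟨ ℕ.+-comm x 1 ⟩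
    suc x          ∎

  fermat-shift : ∀ x n → x ^ (suc n + p₁) ≈ x ^ suc n
  fermat-shift x n = begin
    x ^ (suc n + p₁)  ≡⟨ cong (x ^_) (ℕ.+-suc n p₁) ⟨
    x ^ (n + p)       ≡⟨ ℕ.^-distribˡ-+-* x n p ⟩
    x ^ n * x ^ p     ≈⟨ *-congˡ (x ^ n) (fermat x) ⟩
    x ^ n * x         ≡⟨ ℕ.*-comm (x ^ n) x ⟩
    x ^ suc n         ∎

  -- The totals Σ_{j ≤ k} S(n,j) (k P′ j) = k^n agree for n and n + p - 1, so by
  -- induction on k the top terms agree, and k P′ k = k! is invertible.
  periodic : ∀ n k → k < p → S (suc n + p₁) k ≈ S (suc n) k
  periodic n = <-rec (λ k → k < p → S n′ k ≈ S (suc n) k) step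
    where
    n′ = suc n + p₁

    step : ∀ k → (∀ {j} → j < k → j < p → S n′ j ≈ S (suc n) j) → k < p → S n′ k ≈ S (suc n) k
    step k earlier k<p =
      *-cancelʳ prime k!∤ (Σ<-top k {λ j → S n′ j * (k P′ j)} {λ j → S (suc n) j * (k P′ j)}
        (λ j j<k → *-congʳ (k P′ j) (earlier j<k (ℕ.<-trans j<k k<p))) totals)
      where
      k!∤ : ¬ p ∣ k P′ k
      k!∤ = ≡.subst (λ z → ¬ p ∣ z) (≡.sym (nP′n≡n! k)) (p∤n! k<p)

      totals : Σ< (suc k) (λ j → S n′ j * (k P′ j)) ≈ Σ< (suc k) (λ j → S (suc n) j * (k P′ j))
      totals = begin
        Σ< (suc k) (λ j → S n′ j * (k P′ j))        ≡⟨ power-expansion n′ k ⟨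
        k ^ n′                                     ≈⟨ fermat-shift k n ⟩
        k ^ suc n                                  ≡⟨ power-expansion (suc n) k ⟩
        Σ< (suc k) (λ j → S (suc n) j * (k P′ j))  ∎

  -- In column p the recurrence loses its first term: S(N+1, p) ≡ S(N, p-1).
  S-column-p : ∀ N → S (suc N) p ≈ S N p₁
  S-column-p N = +-congʳ (S N p₁) (multiple≈0 (m∣m*n (S N p)))

  column-shift : ∀ n k → S (n + p) (k + p) ≈ S n k + S (suc n) (k + p)
  column-shift zero zero = ≡⇒≈ (≡.trans (S-diag p) (cong (1 +_) (≡.sym (S-vanish {1} {p} (s≤s (s≤s z≤n))))))
  column-shift zero (suc k) = ≡⇒≈ (≡.trans (S-vanish (ℕ.m<n+m p (s≤s z≤n)))
    (≡.sym (S-vanish (s≤s (ℕ.≤-trans (s≤s z≤n) (ℕ.m≤n+m p k))))))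
  column-shift (suc n) zero = begin
    S (suc (n + p)) p      ≈⟨ S-column-p (n + p) ⟩
    S (n + p) p₁           ≡⟨ cong (λ N → S N p₁) (ℕ.+-suc n p₁) ⟩
    S (suc n + p₁) p₁      ≈⟨ periodic n p₁ (ℕ.n<1+n p₁) ⟩
    S (suc n) p₁           ≈⟨ S-column-p (suc n) ⟨
    S (suc (suc n)) p      ∎
  column-shift (suc n) (suc k) = begin
    (c + p) * S (n + p) (c + p) + S (n + p) (k + p)
      ≈⟨ +-cong (*-congˡ (c + p) (column-shift n c)) (column-shift n k) ⟩
    (c + p) * (S n c + S (suc n) (c + p)) + (S n k + S (suc n) (k + p))
      ≈⟨ +-congʳ (S n k + S (suc n) (k + p)) (*-congʳ (S n c + S (suc n) (c + p)) (+-modulus c)) ⟩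
    c * (S n c + S (suc n) (c + p)) + (S n k + S (suc n) (k + p))
      ≡⟨ ring c (S n c) (S (suc n) (c + p)) (S n k) (S (suc n) (k + p)) ⟩
    (c * S n c + S n k) + (c * S (suc n) (c + p) + S (suc n) (k + p))
      ≈⟨ +-congˡ (c * S n c + S n k) (+-congʳ (S (suc n) (k + p)) (*-congʳ (S (suc n) (c + p)) (+-modulus c))) ⟨
    (c * S n c + S n k) + ((c + p) * S (suc n) (c + p) + S (suc n) (k + p))
      ∎
    where
    c = suc k
    ring : ∀ c a A b B → c * (a + A) + (b + B) ≡ (c * a + b) + (c * A + B)
    ring = solve-∀

  shift : ∀ n a → suc n * p + a ≡ (n * p + a) + p
  shift n a = ring n a p
    where
    ring : ∀ n a p → suc n * p + a ≡ (n * p + a) + p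
    ring = solve-∀

  -- W K s = S(K + s(p-1), K); the diagonal value S(pK, K) is W K K.
  W : ℕ → ℕ → ℕ
  W K s = S (K + s * p₁) K

  W-zero : ∀ K → W K 0 ≡ 1
  W-zero K = ≡.trans (cong (λ N → S N K) (ℕ.+-identityʳ K)) (S-diag K)

  -- Column shift along the diagonal: Pascal's recurrence for W.
  W-recurrence : ∀ K s → W (K + p) (suc s) ≈ W K (suc s) + W (K + p) s
  W-recurrence K s = begin
    S ((K + p) + suc s * p₁) (K + p)                        ≡⟨ cong (λ N → S N (K + p)) (ring₁ K s p₁) ⟩
    S ((K + suc s * p₁) + p) (K + p)                        ≈⟨ column-shift (K + suc s * p₁) K ⟩
    S (K + suc s * p₁) K + S (suc (K + suc s * p₁)) (K + p) ≡⟨ cong (λ N → W K (suc s) + S N (K + p)) (ring₂ K s p₁) ⟩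
    S (K + suc s * p₁) K + S ((K + p) + s * p₁) (K + p)     ∎
    where
    ring₁ : ∀ K s q → (K + suc q) + suc s * q ≡ (K + suc s * q) + suc q
    ring₁ = solve-∀
    ring₂ : ∀ K s q → suc (K + suc s * q) ≡ (K + suc q) + s * q
    ring₂ = solve-∀

  W-base-low : ∀ r s → suc r < p → W (suc r) s ≈ 1
  W-base-low r zero    _   = ≡⇒≈ (W-zero (suc r))
  W-base-low r (suc s) r<p = begin
    S (suc r + suc s * p₁) (suc r)     ≡⟨ cong (λ N → S N (suc r)) (ring r s p₁) ⟩
    S (suc (r + s * p₁) + p₁) (suc r)  ≈⟨ periodic (r + s * p₁) (suc r) r<p ⟩
    S (suc r + s * p₁) (suc r)         ≈⟨ W-base-low r s r<p ⟩
    1                                  ∎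
    where
    ring : ∀ r s q → suc r + suc s * q ≡ suc (r + s * q) + q
    ring = solve-∀

  W-base-p : ∀ s → W p s ≈ 1
  W-base-p zero    = ≡⇒≈ (W-zero p)
  W-base-p (suc s) = ≈-trans (W-recurrence 0 s) (+-congˡ (W 0 (suc s)) (W-base-p s))

  W-base : ∀ r s → 0 < r → r ≤ p → W r s ≈ 1
  W-base (suc r) s _ r≤p with ℕ.m≤n⇒m<n∨m≡n r≤p
  ... | inj₁ r<p    = W-base-low r s r<p
  ... | inj₂ ≡.refl = W-base-p s

  W-closed : ∀ q r s → 0 < r → r ≤ p → W (q * p + r) s ≈ (s + q) C q
  W-closed zero    r s       0<r r≤p = W-base r s 0<r r≤p
  W-closed (suc q) r zero    _   _   = ≡⇒≈ (≡.trans (W-zero (suc q * p + r)) (≡.sym (nCn≡1 (suc q))))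
  W-closed (suc q) r (suc s) 0<r r≤p = begin
    W (suc q * p + r) (suc s)                    ≡⟨ cong (λ L → W L (suc s)) (shift q r) ⟩
    W (K + p) (suc s)                            ≈⟨ W-recurrence K s ⟩
    W K (suc s) + W (K + p) s                    ≡⟨ cong (λ L → W K (suc s) + W L s) (shift q r) ⟨
    W K (suc s) + W (suc q * p + r) s            ≈⟨ +-cong (W-closed q r (suc s) 0<r r≤p) (W-closed (suc q) r s 0<r r≤p) ⟩
    ((suc s + q) C q) + ((s + suc q) C suc q)    ≡⟨ cong (λ n → (n C q) + ((s + suc q) C suc q)) (ℕ.+-suc s q) ⟨
    ((s + suc q) C q) + ((s + suc q) C suc q)    ≡⟨ pascal (s + suc q) q ⟨
    suc (s + suc q) C suc q                      ∎
    where K = q * p + r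

  -- The binomial analogue of column-shift: Pascal's rule modulo p after
  -- shifting the top by p (using p ∣ C(p, k) for 0 < k < p).
  C-shift-low : ∀ n {k} → k < p → (n + p) C k ≈ n C k
  C-shift-low zero    {zero}  _   = ≈-refl
  C-shift-low zero    {suc k} k<p = multiple≈0 (p∣pCk (s≤s z≤n) k<p)
  C-shift-low (suc n) {zero}  _   = ≈-refl
  C-shift-low (suc n) {suc k} k<p = begin
    suc (n + p) C suc k                  ≡⟨ pascal (n + p) k ⟩
    ((n + p) C k) + ((n + p) C suc k)    ≈⟨ +-cong (C-shift-low n (ℕ.<-trans (ℕ.n<1+n k) k<p)) (C-shift-low n k<p) ⟩
    (n C k) + (n C suc k)                ≡⟨ pascal n k ⟨
    suc n C suc k                        ∎

  C-shift-high : ∀ n k → (n + p) C (k + p) ≈ (n C (k + p)) + (n C k)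
  C-shift-high zero    zero    = ≡⇒≈ (nCn≡1 p)
  C-shift-high zero    (suc k) = ≡⇒≈ (k>n⇒nCk≡0 {p} {suc k + p} (ℕ.m<n+m p (s≤s z≤n)))
  C-shift-high (suc n) zero    = begin
    suc (n + p) C p                      ≡⟨ pascal (n + p) p₁ ⟩
    ((n + p) C p₁) + ((n + p) C p)       ≈⟨ +-cong (C-shift-low n (ℕ.n<1+n p₁)) (C-shift-high n zero) ⟩
    (n C p₁) + ((n C p) + 1)             ≡⟨ ℕ.+-assoc (n C p₁) (n C p) 1 ⟨
    ((n C p₁) + (n C p)) + 1             ≡⟨ cong (_+ 1) (pascal n p₁) ⟨
    (suc n C p) + 1                      ∎
  C-shift-high (suc n) (suc k) = begin
    suc (n + p) C suc (k + p)
      ≡⟨ pascal (n + p) (k + p) ⟩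
    ((n + p) C (k + p)) + ((n + p) C (suc k + p))
      ≈⟨ +-cong (C-shift-high n k) (C-shift-high n (suc k)) ⟩
    ((n C (k + p)) + (n C k)) + ((n C (suc k + p)) + (n C suc k))
      ≡⟨ interchange (n C (k + p)) (n C k) (n C (suc k + p)) (n C suc k) ⟩
    ((n C (k + p)) + (n C (suc k + p))) + ((n C k) + (n C suc k))
      ≡⟨ cong₂ _+_ (pascal n (k + p)) (pascal n k) ⟨
    (suc n C (suc k + p)) + (suc n C suc k)
      ∎
    where
    interchange : ∀ a b c d → (a + b) + (c + d) ≡ (a + c) + (b + d)
    interchange = solve-∀

  lucas : ∀ n m {a b} → a < p → b < p → (n * p + a) C (m * p + b) ≈ (a C b) * (n C m)
  lucas zero    zero    {a} {b} _   _   = ≡⇒≈ (≡.sym (ℕ.*-identityʳ (a C b)))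
  lucas zero    (suc m) {a} {b} a<p _   = ≡⇒≈ (≡.trans (k>n⇒nCk≡0 a<top) (≡.sym (ℕ.*-zeroʳ (a C b))))
    where
    a<top : a < suc m * p + b
    a<top = ℕ.<-≤-trans a<p (ℕ.≤-trans (ℕ.m≤m+n p (m * p)) (ℕ.m≤m+n (suc m * p) b))
  lucas (suc n) zero    {a} {b} a<p b<p = begin
    (suc n * p + a) C b        ≡⟨ cong (_C b) (shift n a) ⟩
    ((n * p + a) + p) C b      ≈⟨ C-shift-low (n * p + a) b<p ⟩
    (n * p + a) C b            ≈⟨ lucas n zero a<p b<p ⟩
    (a C b) * 1                ∎
  lucas (suc n) (suc m) {a} {b} a<p b<p = begin
    (suc n * p + a) C (suc m * p + b)
      ≡⟨ cong₂ _C_ (shift n a) (shift m b) ⟩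
    ((n * p + a) + p) C ((m * p + b) + p)
      ≈⟨ C-shift-high (n * p + a) (m * p + b) ⟩
    ((n * p + a) C ((m * p + b) + p)) + ((n * p + a) C (m * p + b))
      ≡⟨ cong (λ k → ((n * p + a) C k) + ((n * p + a) C (m * p + b))) (shift m b) ⟨
    ((n * p + a) C (suc m * p + b)) + ((n * p + a) C (m * p + b))
      ≈⟨ +-cong (lucas n (suc m) a<p b<p) (lucas n m a<p b<p) ⟩
    (a C b) * (n C suc m) + (a C b) * (n C m)
      ≡⟨ ring (a C b) (n C suc m) (n C m) ⟩
    (a C b) * ((n C m) + (n C suc m))
      ≡⟨ cong ((a C b) *_) (pascal n m) ⟨
    (a C b) * (suc n C suc m)
      ∎
    where
    ring : ∀ c x y → c * x + c * y ≡ c * (y + x)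
    ring = solve-∀

  divide : ∀ n → Σ ℕ λ q → Σ ℕ λ r → r < p × n ≡ q * p + r
  divide n = n / p , n % p , m%n<n n p , ≡.trans (m≡m%n+[m/n]*n n p) (ℕ.+-comm (n % p) (n / p * p))

  -- C((t+1)p + t, t+1) ≡ 0. By Lucas this holds when the last digit of t+1 is
  -- nonzero; otherwise it reduces to the same statement for (t+1)/p - 1 < t.
  vanishing : ∀ t → (suc t * p + t) C suc t ≈ 0
  vanishing = <-rec (λ t → (suc t * p + t) C suc t ≈ 0) step
    where
    top : ∀ t Q b → t ≡ Q * p + b → suc t * p + t ≡ (suc t + Q) * p + b
    top t Q b t≡ = ≡.trans (cong (suc t * p +_) t≡) (ring (suc t) Q b p)
      where
      ring : ∀ T Q b p → T * p + (Q * p + b) ≡ (T + Q) * p + b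
      ring = solve-∀

    step : ∀ t → (∀ {u} → u < t → (suc u * p + u) C suc u ≈ 0) → (suc t * p + t) C suc t ≈ 0
    step t smaller with divide (suc t)
    ... | Q , suc b , b<p , 1+t≡ = begin
      (suc t * p + t) C suc t                      ≡⟨ cong₂ _C_ (top t Q b t≡) 1+t≡ ⟩
      ((suc t + Q) * p + b) C (Q * p + suc b)      ≈⟨ lucas (suc t + Q) Q (ℕ.<-trans (ℕ.n<1+n b) b<p) b<p ⟩
      (b C suc b) * ((suc t + Q) C Q)              ≡⟨ cong (_* ((suc t + Q) C Q)) (k>n⇒nCk≡0 (ℕ.n<1+n b)) ⟩
      0                                            ∎
      where
      t≡ : t ≡ Q * p + b
      t≡ = ℕ.suc-injective (≡.trans 1+t≡ (ℕ.+-suc (Q * p) b))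
    ... | suc Q , zero , _ , 1+t≡ = begin
      (suc t * p + t) C suc t                      ≡⟨ cong₂ _C_ (top t Q p₁ t≡) 1+t≡ ⟩
      ((suc t + Q) * p + p₁) C (suc Q * p + 0)     ≈⟨ lucas (suc t + Q) (suc Q) (ℕ.n<1+n p₁) (s≤s z≤n) ⟩
      1 * ((suc t + Q) C suc Q)                    ≡⟨ ℕ.*-identityˡ _ ⟩
      (suc t + Q) C suc Q                          ≡⟨ cong (λ n → (n + Q) C suc Q) (≡.trans 1+t≡ (ℕ.+-identityʳ _)) ⟩
      (suc Q * p + Q) C suc Q                      ≈⟨ smaller Q<t ⟩
      0                                            ∎
      where
      t≡ : t ≡ Q * p + p₁
      t≡ = ℕ.suc-injective (≡.trans 1+t≡ (ring Q p₁))
        where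
        ring : ∀ Q q → suc Q * suc q + 0 ≡ suc (Q * suc q + q)
        ring = solve-∀
      Q<t : Q < t
      Q<t = ≡.subst (Q <_) (≡.sym t≡) (ℕ.<-≤-trans (ℕ.m<m+n Q {p₁} (s≤s z≤n)) (ℕ.+-monoˡ-≤ p₁ (ℕ.m≤m*n Q p)))

  Sₚ : ℕ → ℕ
  Sₚ K = S (p * K) K

  Sₚ≡W : ∀ K → Sₚ K ≡ W K K
  Sₚ≡W K = cong (λ N → S (K + N) K) (ℕ.*-comm p₁ K)

  -- S(pK, K) ≡ C(K + q, q) for K = qp + r with r < p.  For r = 0 the closed
  -- form of W (with last digit p) differs from this by a vanishing term.
  Sₚ-closed : ∀ q r → r < p → Sₚ (q * p + r) ≈ ((q * p + r) + q) C q
  Sₚ-closed q       (suc r) r<p =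
    ≈-trans (≡⇒≈ (Sₚ≡W (q * p + suc r))) (W-closed q (suc r) (q * p + suc r) (s≤s z≤n) (ℕ.<⇒≤ r<p))
  Sₚ-closed zero    zero    _   = ≡⇒≈ (cong (λ N → S N 0) (ℕ.*-zeroʳ p))
  Sₚ-closed (suc t) zero    _   = begin
    Sₚ K                                 ≡⟨ Sₚ≡W K ⟩
    W K K                                ≡⟨ cong (λ L → W L K) (ring t p) ⟩
    W (t * p + p) K                      ≈⟨ W-closed t p K (s≤s z≤n) ℕ.≤-refl ⟩
    (K + t) C t                          ≡⟨ ℕ.+-identityʳ _ ⟨
    ((K + t) C t) + 0                    ≈⟨ +-congˡ ((K + t) C t) vanish ⟨
    ((K + t) C t) + ((K + t) C suc t)    ≡⟨ pascal (K + t) t ⟨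
    suc (K + t) C suc t                  ≡⟨ cong (_C suc t) (ℕ.+-suc K t) ⟨
    (K + suc t) C suc t                  ∎
    where
    K = suc t * p + 0
    ring : ∀ t p → suc t * p + 0 ≡ t * p + p
    ring = solve-∀
    vanish : (K + t) C suc t ≈ 0
    vanish = ≈-trans (≡⇒≈ (cong (λ n → (n + t) C suc t) (ℕ.+-identityʳ (suc t * p)))) (vanishing t)

  digit-step : ∀ M′ {a b} → a < p → b < p →
               Sₚ ((M′ * p + b) * p + a) ≈ ((a + b) C a) * Sₚ (M′ * p + b)
  digit-step M′ {a} {b} a<p b<p with ℕ.≤-<-connex p (a + b)
  ... | inj₂ a+b<p = begin
    Sₚ K                                         ≈⟨ Sₚ-closed M a a<p ⟩
    (K + M) C M                                  ≡⟨ cong (_C M) K+M≡ ⟩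
    ((M + M′) * p + (a + b)) C (M′ * p + b)      ≈⟨ lucas (M + M′) M′ a+b<p b<p ⟩
    ((a + b) C b) * ((M + M′) C M′)              ≡⟨ cong (_* ((M + M′) C M′)) (C-symmetric a b) ⟩
    ((a + b) C a) * ((M + M′) C M′)              ≈⟨ *-congˡ ((a + b) C a) (Sₚ-closed M′ b b<p) ⟨
    ((a + b) C a) * Sₚ M                         ∎
    where
    M = M′ * p + b
    K = M * p + a
    K+M≡ : K + M ≡ (M + M′) * p + (a + b)
    K+M≡ = ring M′ b a p
      where
      ring : ∀ M′ b a p → ((M′ * p + b) * p + a) + (M′ * p + b) ≡ ((M′ * p + b) + M′) * p + (a + b)
      ring = solve-∀
  ... | inj₁ p≤a+b = begin
    Sₚ K                                         ≈⟨ Sₚ-closed M a a<p ⟩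
    (K + M) C M                                  ≡⟨ cong (_C M) K+M≡ ⟩
    (suc (M + M′) * p + c) C (M′ * p + b)        ≈⟨ lucas (suc (M + M′)) M′ (ℕ.<-trans c<b b<p) b<p ⟩
    (c C b) * (suc (M + M′) C M′)                ≡⟨ cong (_* (suc (M + M′) C M′)) (k>n⇒nCk≡0 c<b) ⟩
    0                                            ≡⟨ ℕ.*-zeroˡ (Sₚ M) ⟨
    0 * Sₚ M                                     ≈⟨ *-congʳ (Sₚ M) a+bCa≈0 ⟨
    ((a + b) C a) * Sₚ M                         ∎
    where
    M = M′ * p + b
    K = M * p + a
    c = a + b ∸ p
    a+b≡c+p : a + b ≡ c + p
    a+b≡c+p = ≡.sym (ℕ.m∸n+n≡m p≤a+b)
    c<b : c < b
    c<b = carry< a<p a+b≡c+p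
    c<a : c < a
    c<a = carry< b<p (≡.trans (ℕ.+-comm b a) a+b≡c+p)
    K+M≡ : K + M ≡ suc (M + M′) * p + c
    K+M≡ = ≡.trans (ring₁ M′ b a p) (≡.trans (cong ((M + M′) * p +_) a+b≡c+p) (ring₂ (M + M′) c p))
      where
      ring₁ : ∀ M′ b a p → ((M′ * p + b) * p + a) + (M′ * p + b) ≡ ((M′ * p + b) + M′) * p + (a + b)
      ring₁ = solve-∀
      ring₂ : ∀ X c p → X * p + (c + p) ≡ suc X * p + c
      ring₂ = solve-∀
    a+bCa≈0 : (a + b) C a ≈ 0
    a+bCa≈0 = begin
      (a + b) C a                  ≡⟨ cong (_C a) (≡.trans a+b≡c+p (ring c p)) ⟩
      (1 * p + c) C (0 * p + a)    ≈⟨ lucas 1 0 (ℕ.<-trans c<a a<p) a<p ⟩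
      (c C a) * 1                  ≡⟨ cong (_* 1) (k>n⇒nCk≡0 c<a) ⟩
      0                            ∎
      where
      ring : ∀ c p → c + p ≡ 1 * p + c
      ring = solve-∀

  diagonal-digits : ∀ as → All (_< p) as → Sₚ (fromDigits p as) ≈ digitProd as
  diagonal-digits []           []                = ≡⇒≈ (cong (λ N → S N 0) (ℕ.*-zeroʳ p))
  diagonal-digits (a ∷ [])     (a<p ∷ [])        = begin
    Sₚ (a + p * 0)          ≡⟨ cong Sₚ (≡.trans (cong (a +_) (ℕ.*-zeroʳ p)) (ℕ.+-identityʳ a)) ⟩
    Sₚ a                    ≈⟨ digit-step 0 a<p (s≤s z≤n) ⟩
    ((a + 0) C a) * Sₚ 0    ≈⟨ *-congˡ ((a + 0) C a) (diagonal-digits [] []) ⟩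
    ((a + 0) C a) * 1       ≡⟨ ℕ.*-identityʳ _ ⟩
    (a + 0) C a             ∎
  diagonal-digits (a ∷ b ∷ cs) (a<p ∷ b<p ∷ cs<p) = begin
    Sₚ (a + p * (b + p * M′))             ≡⟨ cong Sₚ (ring₁ a b M′ p) ⟩
    Sₚ ((M′ * p + b) * p + a)             ≈⟨ digit-step M′ a<p b<p ⟩
    ((a + b) C a) * Sₚ (M′ * p + b)       ≡⟨ cong (λ M → ((a + b) C a) * Sₚ M) (ring₂ b M′ p) ⟩
    ((a + b) C a) * Sₚ (b + p * M′)       ≈⟨ *-congˡ ((a + b) C a) (diagonal-digits (b ∷ cs) (b<p ∷ cs<p)) ⟩
    ((a + b) C a) * digitProd (b ∷ cs)    ∎
    where
    M′ = fromDigits p cs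
    ring₁ : ∀ a b M p → a + p * (b + p * M) ≡ (M * p + b) * p + a
    ring₁ = solve-∀
    ring₂ : ∀ b M p → M * p + b ≡ b + p * M
    ring₂ = solve-∀

corollary2p5 : (p : ℕ) → (pp : Prime p) → (as : List ℕ) → All (_< p) as →
               1 ≤ fromDigits p as →
               _%_ (S (p * fromDigits p as) (fromDigits p as)) p {{prime⇒nonZero pp}} ≡ _%_ (digitProd as) p {{prime⇒nonZero pp}}
corollary2p5 zero           pp = ⊥-elim (¬prime[0] pp)
corollary2p5 (suc zero)     pp = ⊥-elim (¬prime[1] pp)
corollary2p5 (suc (suc p₂)) pp as digits _ = Congruence.residues (ModP.diagonal-digits p₂ pp as digits)
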